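{- Let $a=a_1\dots a_n$ be a binary sequence and let $\operatorname{rev}a=a_n\dots a_1$. Then the dual poset $\mathcal{P}_a^\circ$ is isomorphic to $\mathcal{P}_{\operatorname{rev}a}$.
   Context: Two binary sequences $b,c$ of the same length are opposed if there are positions $i,j$ with $b_i>c_i$ and $b_j<c_j$. For a binary sequence $a=a_1\dots a_n$ ($n\ge 0$) define sequences of length $n+1$: $a(0)=1a_1\dots a_n$; for $1\le i\le n$, $a(i)=a_1\dots a_{i-1}\,0\,1\,a_{i+1}\dots a_n$; $a(n+1)=a_1\dots a_n0$ (these are distinct). $\mathcal{P}_a$ is the poset on $\{a(0),\dots,a(n+1)\}$ with $a(i)\triangleleft a(j)$ iff $i<j$ and $a(i),a(j)$ are opposed. $P^\circ$ denotes the dual poset (same set, reversed order). -}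

module Defs where

open import Data.Bool using (Bool; true; false)
open import Data.Nat using (ℕ; zero; suc)
open import Data.Fin using (Fin; zero; suc; _<_)
open import Data.Vec using (Vec; []; _∷_; reverse)
open import Data.Product using (Σ; ∃; _×_; _,_)
open import Relation.Binary.Construct.Closure.ReflexiveTransitive using (Star)
open import Function.Bundles using (_↔_; Inverse)
open import Relation.Binary.PropositionalEquality using (_≡_)

BinSeq : ℕ → Set
BinSeq n = Vec Bool n

data _>ᵇ_ : Bool → Bool → Set where
  1>0 : true >ᵇ false

data SomeGreater : ∀ {m} → Vec Bool m → Vec Bool m → Set where
  here  : ∀ {m x y} {xs ys : Vec Bool m} → x >ᵇ y → SomeGreater (x ∷ xs) (y ∷ ys)
  there : ∀ {m x y} {xs ys : Vec Bool m} → SomeGreater xs ys → SomeGreater (x ∷ xs) (y ∷ ys)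

Opposed : ∀ {m} → Vec Bool m → Vec Bool m → Set
Opposed b c = SomeGreater b c × SomeGreater c b

-- a(i) for i = 0 .. n+1  (index i : Fin (n + 2)).
-- a(0) = 1 a ; a(n+1) = a 0 ; a(i) = a_1..a_{i-1} 0 1 a_{i+1}..a_n.
ins : ∀ {n} → Vec Bool n → Fin (suc (suc n)) → Vec Bool (suc n)
ins a zero = true ∷ a
ins [] (suc zero) = false ∷ []
ins (x ∷ a) (suc zero) = false ∷ true ∷ a
ins (x ∷ a) (suc (suc i)) = x ∷ ins a (suc i)

_◁[_]_ : ∀ {n} → Fin (suc (suc n)) → Vec Bool n → Fin (suc (suc n)) → Set
i ◁[ a ] j = (i < j) × Opposed (ins a i) (ins a j)

-- The order ≤ of P_a on {a(0),...,a(n+1)}, indexed by i (the a(i) are distinct),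
-- taken as the reflexive-transitive closure of ◁.
_≤[_]_ : ∀ {n} → Fin (suc (suc n)) → Vec Bool n → Fin (suc (suc n)) → Set
i ≤[ a ] j = Star (λ x y → x ◁[ a ] y) i j

-- P_a° ≅ P_b : a bijection f of the underlying sets with
-- x ≤ y in P_a°  (i.e. y ≤ x in P_a)  iff  f x ≤ f y in P_b.
DualIso : ∀ {n} → Vec Bool n → Vec Bool n → Set
DualIso {n} a b =
  Σ (Fin (suc (suc n)) ↔ Fin (suc (suc n))) λ f →
    ∀ x y → (y ≤[ a ] x → Inverse.to f x ≤[ b ] Inverse.to f y)
          × (Inverse.to f x ≤[ b ] Inverse.to f y → y ≤[ a ] x)

-- The points a(0), …, a(n+1) of 𝒫ₐ are exactly the n + 2 distinct words obtained from a by
-- inserting one bit, so reversal maps the points of 𝒫ₐ bijectively onto those of 𝒫_{rev a}.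
-- Two opposed insertions cannot share their insertion point, and for opposed points the
-- index order i < j is the order of the insertion points.  Reversal turns that order
-- around, hence sends each generating relation a(i) ◁ a(j) to a reversed one.
module Submission where

open import Defs
open import Data.Nat using (ℕ; suc; s≤s)
open import Data.Vec using (Vec; reverse; []; _∷_; _∷ʳ_; tail)
open import Data.Bool using (Bool; true; false)
open import Data.Fin using (Fin; zero; suc; _<_)
open import Data.Fin.Properties using (<-cmp)
open import Data.Vec.Properties using (reverse-∷; reverse-involutive)
open import Data.Product using (∃; _,_; proj₁; proj₂)
open import Data.Empty using (⊥-elim)
open import Relation.Nullary using (¬_)
open import Relation.Binary using (tri<; tri≈; tri>)
open import Relation.Binary.PropositionalEquality
  using (_≡_; _≢_; refl; sym; cong; subst; subst₂; module ≡-Reasoning)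
open import Relation.Binary.Construct.Closure.ReflexiveTransitive as Star using (gmap)
open import Function using (_∘_)
open import Function.Bundles using (_↔_; mk↔ₛ′)
open import Function.Definitions using (Injective)

SomeGreater-irrefl : ∀ {m} (d : Vec Bool m) → ¬ SomeGreater d d
SomeGreater-irrefl (x ∷ d) (here ())
SomeGreater-irrefl (x ∷ d) (there p) = SomeGreater-irrefl d p

SomeGreater-tail : ∀ {m z} {d e : Vec Bool m} → SomeGreater (z ∷ d) (z ∷ e) → SomeGreater d e
SomeGreater-tail (here ())
SomeGreater-tail (there p) = p

SomeGreater-∷ʳ : ∀ {m x y} {d e : Vec Bool m} → SomeGreater d e → SomeGreater (d ∷ʳ x) (e ∷ʳ y)
SomeGreater-∷ʳ (here p) = here p
SomeGreater-∷ʳ (there p) = there (SomeGreater-∷ʳ p)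

SomeGreater-last : ∀ {m x y} (d e : Vec Bool m) → x >ᵇ y → SomeGreater (d ∷ʳ x) (e ∷ʳ y)
SomeGreater-last [] [] p = here p
SomeGreater-last (_ ∷ d) (_ ∷ e) p = there (SomeGreater-last d e p)

SomeGreater-reverse : ∀ {m} {d e : Vec Bool m} → SomeGreater d e → SomeGreater (reverse d) (reverse e)
SomeGreater-reverse (here {x = x} {y} {d} {e} p) =
  subst₂ SomeGreater (sym (reverse-∷ x d)) (sym (reverse-∷ y e)) (SomeGreater-last (reverse d) (reverse e) p)
SomeGreater-reverse (there {x = x} {y} {d} {e} p) =
  subst₂ SomeGreater (sym (reverse-∷ x d)) (sym (reverse-∷ y e)) (SomeGreater-∷ʳ (SomeGreater-reverse p))

Opposed-irrefl : ∀ {m} (d : Vec Bool m) → ¬ Opposed d d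
Opposed-irrefl d (p , _) = SomeGreater-irrefl d p

Opposed-sym : ∀ {m} {d e : Vec Bool m} → Opposed d e → Opposed e d
Opposed-sym (p , q) = q , p

Opposed-reverse : ∀ {m} {d e : Vec Bool m} → Opposed d e → Opposed (reverse d) (reverse e)
Opposed-reverse (p , q) = SomeGreater-reverse p , SomeGreater-reverse q

¬Opposed-∷ : ∀ {m z} {d e : Vec Bool m} → ¬ Opposed d e → ¬ Opposed (z ∷ d) (z ∷ e)
¬Opposed-∷ h (p , q) = h (SomeGreater-tail p , SomeGreater-tail q)

¬Opposed-heads : ∀ {m x y} (a : Vec Bool m) → ¬ Opposed (x ∷ a) (y ∷ a)
¬Opposed-heads a (here 1>0 , here ())
¬Opposed-heads a (here _ , there q) = SomeGreater-irrefl a q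
¬Opposed-heads a (there p , _) = SomeGreater-irrefl a p

data Insertion (x : Bool) : ∀ {n} → Vec Bool n → Vec Bool (suc n) → Set where
  here  : ∀ {n} {a : Vec Bool n} → Insertion x a (x ∷ a)
  there : ∀ {n z} {a : Vec Bool n} {d} → Insertion x a d → Insertion x (z ∷ a) (z ∷ d)

Insertion-last : ∀ {n} x (a : Vec Bool n) → Insertion x a (a ∷ʳ x)
Insertion-last x [] = here
Insertion-last x (y ∷ a) = there (Insertion-last x a)

Insertion-∷ʳ : ∀ {n x z} {a : Vec Bool n} {d} → Insertion x a d → Insertion x (a ∷ʳ z) (d ∷ʳ z)
Insertion-∷ʳ here = here
Insertion-∷ʳ (there p) = there (Insertion-∷ʳ p)

Insertion-reverse : ∀ {n x} {a : Vec Bool n} {d} → Insertion x a d → Insertion x (reverse a) (reverse d)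
Insertion-reverse {x = x} {a} here =
  subst (Insertion x (reverse a)) (sym (reverse-∷ x a)) (Insertion-last x (reverse a))
Insertion-reverse {x = x} (there {z = z} {a = a} {d = d} p) =
  subst₂ (Insertion x) (sym (reverse-∷ z a)) (sym (reverse-∷ z d)) (Insertion-∷ʳ (Insertion-reverse p))

ins-Insertion : ∀ {n} (a : Vec Bool n) j → ∃ λ x → Insertion x a (ins a j)
ins-Insertion a zero = true , here
ins-Insertion [] (suc zero) = false , here
ins-Insertion (true ∷ a) (suc zero) = false , here
ins-Insertion (false ∷ a) (suc zero) = true , there here
ins-Insertion (x ∷ a) (suc (suc j)) with ins-Insertion a (suc j)
... | y , p = y , there p

ins-false∷ : ∀ {n} (a : Vec Bool n) → ∃ λ k → ins a k ≡ false ∷ a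
ins-false∷ [] = suc zero , refl
ins-false∷ (true ∷ a) = suc zero , refl
ins-false∷ (false ∷ a) with ins-false∷ a
... | suc k , eq = suc (suc k) , cong (false ∷_) eq

Insertion-ins : ∀ {n x} {a : Vec Bool n} {d} → Insertion x a d → ∃ λ k → ins a k ≡ d
Insertion-ins {x = true} here = zero , refl
Insertion-ins {x = false} {a} here = ins-false∷ a
Insertion-ins (there {z = z} p) = extend z (Insertion-ins p)
  where
  extend : ∀ {n} {a : Vec Bool n} {d} z → (∃ λ k → ins a k ≡ d) → ∃ λ k → ins (z ∷ a) k ≡ z ∷ d
  extend true (zero , eq) = zero , cong (true ∷_) eq
  extend false (zero , eq) = suc zero , cong (false ∷_) eq
  extend z (suc k , eq) = suc (suc k) , cong (z ∷_) eq

ins-zero≢suc : ∀ {n} (a : Vec Bool n) j → ins a zero ≢ ins a (suc j)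
ins-zero≢suc [] zero ()
ins-zero≢suc (x ∷ a) zero ()
ins-zero≢suc (false ∷ a) (suc j) ()
ins-zero≢suc (true ∷ a) (suc j) eq = ins-zero≢suc a j (cong tail eq)

ins-injective : ∀ {n} (a : Vec Bool n) → Injective _≡_ _≡_ (ins a)
ins-injective a {zero} {zero} _ = refl
ins-injective a {zero} {suc j} eq = ⊥-elim (ins-zero≢suc a j eq)
ins-injective a {suc i} {zero} eq = ⊥-elim (ins-zero≢suc a i (sym eq))
ins-injective [] {suc zero} {suc zero} _ = refl
ins-injective (x ∷ a) {suc zero} {suc zero} _ = refl
ins-injective (x ∷ a) {suc zero} {suc (suc j)} eq = ⊥-elim (ins-zero≢suc a j (cong tail eq))
ins-injective (x ∷ a) {suc (suc i)} {suc zero} eq = ⊥-elim (ins-zero≢suc a i (sym (cong tail eq)))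
ins-injective (x ∷ a) {suc (suc i)} {suc (suc j)} eq = cong suc (ins-injective a (cong tail eq))

-- d and e are insertions into a, the one in d at a position no later than the one in e.
data InsertedNoLater : ∀ {n} → Vec Bool n → Vec Bool (suc n) → Vec Bool (suc n) → Set where
  here  : ∀ {n x y} {a : Vec Bool n} {e} → Insertion y a e → InsertedNoLater a (x ∷ a) e
  there : ∀ {n z} {a : Vec Bool n} {d e} → InsertedNoLater a d e → InsertedNoLater (z ∷ a) (z ∷ d) (z ∷ e)

InsertedNoLater-last : ∀ {n x y} {a : Vec Bool n} {d} → Insertion x a d → InsertedNoLater a d (a ∷ʳ y)
InsertedNoLater-last {y = y} {a} here = here (Insertion-last y a)
InsertedNoLater-last (there p) = there (InsertedNoLater-last p)

InsertedNoLater-∷ʳ : ∀ {n z} {a : Vec Bool n} {d e} →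
                     InsertedNoLater a d e → InsertedNoLater (a ∷ʳ z) (d ∷ʳ z) (e ∷ʳ z)
InsertedNoLater-∷ʳ (here p) = here (Insertion-∷ʳ p)
InsertedNoLater-∷ʳ (there p) = there (InsertedNoLater-∷ʳ p)

InsertedNoLater-reverse : ∀ {n} {a : Vec Bool n} {d e} →
                          InsertedNoLater a d e → InsertedNoLater (reverse a) (reverse e) (reverse d)
InsertedNoLater-reverse {a = a} (here {x = x} p) =
  subst (InsertedNoLater (reverse a) _) (sym (reverse-∷ x a)) (InsertedNoLater-last (Insertion-reverse p))
InsertedNoLater-reverse (there {z = z} {a = a} {d = d} {e = e} p) =
  subst₂ (λ u v → InsertedNoLater u v (reverse (z ∷ d))) (sym (reverse-∷ z a)) (sym (reverse-∷ z e))
    (subst (InsertedNoLater (reverse a ∷ʳ z) (reverse e ∷ʳ z)) (sym (reverse-∷ z d))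
      (InsertedNoLater-∷ʳ (InsertedNoLater-reverse p)))

-- Insertions at a common point differ in at most one position.
InsertedNoLater-both⇒¬Opposed : ∀ {n} (a : Vec Bool n) {d e} →
                                InsertedNoLater a d e → InsertedNoLater a e d → ¬ Opposed d e
InsertedNoLater-both⇒¬Opposed a (here _) (here _) = ¬Opposed-heads a
InsertedNoLater-both⇒¬Opposed (z ∷ a) (there p) (there q) =
  ¬Opposed-∷ (InsertedNoLater-both⇒¬Opposed a p q)
InsertedNoLater-both⇒¬Opposed (z ∷ a) (here here) (there q) = Opposed-irrefl _
InsertedNoLater-both⇒¬Opposed (z ∷ a) (here (there p)) (there q) =
  ¬Opposed-∷ (InsertedNoLater-both⇒¬Opposed a (here p) q)
InsertedNoLater-both⇒¬Opposed (z ∷ a) (there q) (here here) = Opposed-irrefl _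
InsertedNoLater-both⇒¬Opposed (z ∷ a) (there q) (here (there p)) =
  ¬Opposed-∷ (InsertedNoLater-both⇒¬Opposed a (here p) q) ∘ Opposed-sym

ins-<⇒InsertedNoLater : ∀ {n} (a : Vec Bool n) {i j} → i < j → InsertedNoLater a (ins a i) (ins a j)
ins-<⇒InsertedNoLater a {zero} {j} _ = here (proj₂ (ins-Insertion a j))
ins-<⇒InsertedNoLater (true ∷ a) {suc zero} {suc (suc j)} _ =
  here (proj₂ (ins-Insertion (true ∷ a) (suc (suc j))))
ins-<⇒InsertedNoLater (false ∷ a) {suc zero} {suc (suc j)} _ =
  there (here (proj₂ (ins-Insertion a (suc j))))
ins-<⇒InsertedNoLater (x ∷ a) {suc (suc i)} {suc (suc j)} (s≤s i<j) = there (ins-<⇒InsertedNoLater a i<j)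
ins-<⇒InsertedNoLater [] {suc zero} {suc zero} (s≤s ())
ins-<⇒InsertedNoLater (x ∷ a) {suc zero} {suc zero} (s≤s ())

reverse-ins : ∀ {n} (a : Vec Bool n) {b} → reverse a ≡ b → ∀ i → ∃ λ k → ins b k ≡ reverse (ins a i)
reverse-ins a refl i = Insertion-ins (Insertion-reverse (proj₂ (ins-Insertion a i)))

module Mirror {n} {a b : Vec Bool n} (rev-a≡b : reverse a ≡ b) where

  mirror : Fin (suc (suc n)) → Fin (suc (suc n))
  mirror i = proj₁ (reverse-ins a rev-a≡b i)

  ins-mirror : ∀ i → ins b (mirror i) ≡ reverse (ins a i)
  ins-mirror i = proj₂ (reverse-ins a rev-a≡b i)

  mirror-InsertedNoLater : ∀ {i j} → i < j → InsertedNoLater b (ins b (mirror j)) (ins b (mirror i))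
  mirror-InsertedNoLater {i} {j} i<j =
    subst₂ (InsertedNoLater b) (sym (ins-mirror j)) (sym (ins-mirror i))
      (subst (λ c → InsertedNoLater c _ _) rev-a≡b
        (InsertedNoLater-reverse (ins-<⇒InsertedNoLater a i<j)))

  mirror-Opposed : ∀ {i j} → Opposed (ins a i) (ins a j) → Opposed (ins b (mirror j)) (ins b (mirror i))
  mirror-Opposed {i} {j} opp =
    subst₂ Opposed (sym (ins-mirror j)) (sym (ins-mirror i)) (Opposed-sym (Opposed-reverse opp))

  ◁-mirror : ∀ {i j} → i ◁[ a ] j → mirror j ◁[ b ] mirror i
  ◁-mirror {i} {j} (i<j , opp) with <-cmp (mirror j) (mirror i)
  ... | tri< lt _ _ = lt , mirror-Opposed opp
  ... | tri≈ _ eq _ =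
    ⊥-elim (Opposed-irrefl _ (subst (λ k → Opposed (ins b k) (ins b (mirror i))) eq (mirror-Opposed opp)))
  ... | tri> _ _ gt =
    ⊥-elim (InsertedNoLater-both⇒¬Opposed b (ins-<⇒InsertedNoLater b gt) (mirror-InsertedNoLater i<j)
              (Opposed-sym (mirror-Opposed opp)))

  ≤-mirror : ∀ {i j} → i ≤[ a ] j → mirror j ≤[ b ] mirror i
  ≤-mirror = Star.reverse (λ r → r) ∘ gmap mirror ◁-mirror

mirror-inverse : ∀ {n} {a b : Vec Bool n} (rev-a≡b : reverse a ≡ b) (rev-b≡a : reverse b ≡ a) →
                 ∀ i → Mirror.mirror {a = b} {a} rev-b≡a (Mirror.mirror {a = a} {b} rev-a≡b i) ≡ i
mirror-inverse {a = a} {b} rev-a≡b rev-b≡a i = ins-injective a (begin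
  ins a (b→a.mirror (a→b.mirror i))  ≡⟨ b→a.ins-mirror (a→b.mirror i) ⟩
  reverse (ins b (a→b.mirror i))     ≡⟨ cong reverse (a→b.ins-mirror i) ⟩
  reverse (reverse (ins a i))        ≡⟨ reverse-involutive (ins a i) ⟩
  ins a i                            ∎)
  where
  open ≡-Reasoning
  module a→b = Mirror {a = a} {b} rev-a≡b
  module b→a = Mirror {a = b} {a} rev-b≡a

proposition4p9 : (n : ℕ) (a : Vec Bool n) → DualIso a (reverse a)
proposition4p9 n a = iso , λ x y → to.≤-mirror , from-≤
  where
  rev-rev-a≡a : reverse (reverse a) ≡ a
  rev-rev-a≡a = reverse-involutive a

  module to = Mirror {a = a} refl
  module from = Mirror {a = reverse a} rev-rev-a≡a

  from∘to : ∀ i → from.mirror (to.mirror i) ≡ i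
  from∘to = mirror-inverse refl rev-rev-a≡a

  iso : Fin (suc (suc n)) ↔ Fin (suc (suc n))
  iso = mk↔ₛ′ to.mirror from.mirror (mirror-inverse rev-rev-a≡a refl) from∘to

  from-≤ : ∀ {x y} → to.mirror x ≤[ reverse a ] to.mirror y → y ≤[ a ] x
  from-≤ {x} {y} le = subst₂ (λ u v → u ≤[ a ] v) (from∘to y) (from∘to x) (from.≤-mirror le)
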